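{- (Provable in $S^1_2$.) If a computation $\sigma$ contains a statement $\langle v,\rho\rangle\downarrow w$ in which $v$ and $w$ are both g-numerals, then $v\preceq w$.
   Context: Approximate terms: terms of $\mathrm{PV}$ (constant $\epsilon$, successors $s_0,s_1$, function symbols for Cobham-derived functions: $\epsilon^n$, $\mathrm{proj}^i_n$, composition, recursion on notation) plus a new constant $*$. A g-numeral is an approximate term built from $\epsilon,s_0,s_1,*$. $r\preceq *$ for all $r$, $r\preceq r$, and $f(\bar r)\preceq f(\bar t)$ when $r_i\preceq t_i$ for all $i$. A development is a sequence of substitutions $[t_1/x_1]\cdots[t_n/x_n]$, $x_i$ distinct, $x_i\notin FV(t_i)$; $()$ is the empty one. Computation statements $\langle t,\rho\rangle\downarrow v$ ($v$ a g-numeral) are derived by the rules (with $X$ the set of argument indices $i$ whose argument $t_i$ is not a g-numeral, $v_i:=t_i$ for $i\notin X$): (Subst) $\langle t,\rho_2\rangle\downarrow v\Rightarrow\langle x,\rho_1[t/x]\rho_2\rangle\downarrow v$, $\rho_1$ without substitution for $x$; ($*$) $\langle t,\rho\rangle\downarrow *$; ($\epsilon n$) $\langle\epsilon,()\rangle\downarrow\epsilon$; ($\epsilon$) $\langle\epsilon,()\rangle\downarrow\epsilon\Rightarrow\langle\epsilon,\rho\rangle\downarrow\epsilon$ for $\rho\neq()$; ($s_i$) $\langle s_iv^*,()\rangle\downarrow s_iv^*,\ \langle t,\rho\rangle\downarrow v\Rightarrow\langle s_it,\rho\rangle\downarrow s_iv^*$ with $v^*$ an approximation of $v$ and ($t\not\equiv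 v^*$ or $\rho\ne()$); ($s_in$) $\langle v,()\rangle\downarrow v\Rightarrow\langle s_iv,()\rangle\downarrow s_iv$ for g-numeral $v$; ($\epsilon^m$) $\langle\epsilon,()\rangle\downarrow\epsilon,(\langle t_i,\rho\rangle\downarrow v_i)_{i\in X}\Rightarrow\langle\epsilon^m(\bar t),\rho\rangle\downarrow\epsilon$; ($\mathrm{proj}^i_m$) $\langle v_i^*,()\rangle\downarrow v_i^*,(\langle t_j,\rho\rangle\downarrow v_j)_{j\in X}\Rightarrow\langle\mathrm{proj}^i_m(\bar t),\rho\rangle\downarrow v_i^*$, $v_i^*$ approximating $v_i$; (comp) for $f=g(h^1,\dots,h^m)$: $\langle g(\bar w^*),()\rangle\downarrow z$, $\langle h^j(\bar v^j),()\rangle\downarrow w_j$, $(\langle t_i,\rho\rangle\downarrow v_i)_{i\in X}\Rightarrow\langle f(\bar t),\rho\rangle\downarrow z$ ($\bar v^j$ approximating $\bar v$, $\bar w^*$ approximating $\bar w$); (rec-$\epsilon$) for $f$ defined by recursion on notation from $g_\epsilon,g_0,g_1$: $\langle g_\epsilon(\bar v^1),()\rangle\downarrow z$, [$\langle t,\rho\rangle\downarrow\epsilon$ if $t$ is not a g-numeral], $(\langle t_j,\rho\rangle\downarrow v_j)_{j\in X}\Rightarrow\langle f(t,\bar t),\rho\rangle\downarrow z$; (rec-$s_i$) $\langle g_i(v^1_0,w^1,\bar v^1),()\rangle\downarrow z$, [$\langle t,\rho\rangle\downarrow s_iv_0$ if $t$ is not a g-numeral], $\langle f(v^2_0,\bar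 v^2),()\rangle\downarrow w$, $(\langle t_j,\rho\rangle\downarrow v_j)_{j\in X}\Rightarrow\langle f(t,\bar t),\rho\rangle\downarrow z$ (superscripted values approximating the corresponding $v_0,\bar v,w$). A computation is a finite sequence of statements, each obtained by one rule from earlier entries; "$\sigma$ contains" a statement means it occurs as an entry. -}

module Defs where

open import Data.Nat using (ℕ; suc; _+_)
open import Data.Fin using (Fin)
open import Data.Vec using (Vec; []; _∷_; lookup)
open import Data.List using (List; []; _∷_; _++_; _∷ʳ_; map)
open import Data.List.Membership.Propositional using (_∈_)
open import Data.List.Relation.Unary.Unique.Propositional using (Unique)
open import Data.Product using (_×_; _,_; proj₁; Σ)
open import Data.Sum using (_⊎_)
open import Relation.Binary.PropositionalEquality using (_≡_; _≢_)
open import Relation.Nullary using (¬_)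

-- Function symbols of PV (Cobham-derived functions), indexed by arity.
-- The successors s₀, s₁ are the unary symbols succF b0, succF b1 (so that
-- they can occur as g or h^j in a composition).

data Bit : Set where
  b0 b1 : Bit

data FSym : ℕ → Set where
  succF : Bit → FSym 1
  epsF  : (n : ℕ) → FSym n
  projF : (n : ℕ) → Fin n → FSym n
  compF : ∀ {k n} → FSym k → Vec (FSym n) k → FSym n
  recF  : ∀ {n} → FSym n → FSym (2 + n) → FSym (2 + n) → FSym (suc n)
          -- recursion on notation from g_ε, g_0, g_1; g_i(v₀, w, v̄)

select : ∀ {n} → Bit → FSym n → FSym n → FSym n
select b0 g₀ g₁ = g₀
select b1 g₀ g₁ = g₁

-- Approximate terms: PV terms plus the new constant *.

Var : Set
Var = ℕ

data Term : Set where
  var  : Var → Term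
  eps  : Term
  star : Term
  app  : ∀ {n} → FSym n → Vec Term n → Term

s : Bit → Term → Term
s b t = app (succF b) (t ∷ [])

data GNum : Term → Set where
  gε : GNum eps
  g* : GNum star
  gs : ∀ {b v} → GNum v → GNum (s b v)

data _⪯_ : Term → Term → Set where
  ⪯* : ∀ {r} → r ⪯ star
  ⪯refl : ∀ {r} → r ⪯ r
  ⪯app : ∀ {n} (f : FSym n) {rs ts : Vec Term n} →
         (∀ i → lookup rs i ⪯ lookup ts i) → app f rs ⪯ app f ts

_⪯ᵛ_ : ∀ {n} → Vec Term n → Vec Term n → Set
vs ⪯ᵛ us = ∀ i → lookup vs i ⪯ lookup us i

data _occursIn_ (x : Var) : Term → Set where
  here : x occursIn var x
  there : ∀ {n} {f : FSym n} {ts : Vec Term n} (i : Fin n) →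
          x occursIn lookup ts i → x occursIn app f ts

-- Developments [t₁/x₁]⋯[tₙ/xₙ], as lists of pairs (xᵢ , tᵢ), left to right.

Dev : Set
Dev = List (Var × Term)

dom : Dev → List Var
dom = map proj₁

data SubOK : Var × Term → Set where
  subOK : ∀ {x t} → ¬ (x occursIn t) → SubOK (x , t)

data AllSubOK : Dev → Set where
  []  : AllSubOK []
  _∷_ : ∀ {p ρ} → SubOK p → AllSubOK ρ → AllSubOK (p ∷ ρ)

IsDev : Dev → Set
IsDev ρ = Unique (dom ρ) × AllSubOK ρ

record Stmt : Set where
  constructor ⟨_,_⟩↓_
  field
    term : Term
    dev  : Dev
    val  : Term

-- An argument tᵢ of f(t̄) together with its value vᵢ:
-- if tᵢ is a g-numeral then vᵢ := tᵢ (i ∉ X), otherwise (i ∈ X) the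
-- statement ⟨tᵢ,ρ⟩↓vᵢ must be an earlier entry.
data ArgOK (prev : List Stmt) (ρ : Dev) : Term → Term → Set where
  isNum  : ∀ {t} → GNum t → ArgOK prev ρ t t
  notNum : ∀ {t v} → ¬ GNum t → (⟨ t , ρ ⟩↓ v) ∈ prev → ArgOK prev ρ t v

ArgsOK : List Stmt → Dev → ∀ {n} → Vec Term n → Vec Term n → Set
ArgsOK prev ρ ts vs = ∀ i → ArgOK prev ρ (lookup ts i) (lookup vs i)

data Rule (prev : List Stmt) : Stmt → Set where
  r-subst : ∀ {x t v ρ₁ ρ₂} → ¬ (x ∈ dom ρ₁) →
            (⟨ t , ρ₂ ⟩↓ v) ∈ prev →
            Rule prev (⟨ var x , ρ₁ ++ ((x , t) ∷ ρ₂) ⟩↓ v)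
  r-star  : ∀ {t ρ} → Rule prev (⟨ t , ρ ⟩↓ star)
  r-εn    : Rule prev (⟨ eps , [] ⟩↓ eps)
  r-ε     : ∀ {ρ} → (⟨ eps , [] ⟩↓ eps) ∈ prev → ρ ≢ [] →
            Rule prev (⟨ eps , ρ ⟩↓ eps)
  r-s0    : ∀ {b v*} → GNum v* → Rule prev (⟨ s b v* , [] ⟩↓ s b v*)
  r-s     : ∀ {b t ρ v v*} → (⟨ t , ρ ⟩↓ v) ∈ prev → v ⪯ v* →
            (t ≢ v* ⊎ ρ ≢ []) →
            Rule prev (⟨ s b t , ρ ⟩↓ s b v*)
  r-sn    : ∀ {b v} → GNum v → (⟨ v , [] ⟩↓ v) ∈ prev →
            Rule prev (⟨ s b v , [] ⟩↓ s b v)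
  r-εm    : ∀ {m ρ} {ts vs : Vec Term m} →
            (⟨ eps , [] ⟩↓ eps) ∈ prev → ArgsOK prev ρ ts vs →
            Rule prev (⟨ app (epsF m) ts , ρ ⟩↓ eps)
  r-proj  : ∀ {m ρ} {i : Fin m} {ts vs : Vec Term m} {v*} →
            lookup vs i ⪯ v* → (⟨ v* , [] ⟩↓ v*) ∈ prev →
            ArgsOK prev ρ ts vs →
            Rule prev (⟨ app (projF m i) ts , ρ ⟩↓ v*)
  r-comp  : ∀ {k m ρ z} {g : FSym k} {hs : Vec (FSym m) k}
              {ts vs : Vec Term m} {ws ws* : Vec Term k}
              (vss : Fin k → Vec Term m) →
            (∀ j → vs ⪯ᵛ vss j) → ws ⪯ᵛ ws* →
            (⟨ app g ws* , [] ⟩↓ z) ∈ prev →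
            (∀ j → (⟨ app (lookup hs j) (vss j) , [] ⟩↓ lookup ws j) ∈ prev) →
            ArgsOK prev ρ ts vs →
            Rule prev (⟨ app (compF g hs) ts , ρ ⟩↓ z)
  r-recε  : ∀ {n ρ z t} {gε : FSym n} {g₀ g₁ : FSym (2 + n)}
              {ts vs vs¹ : Vec Term n} →
            vs ⪯ᵛ vs¹ →
            (⟨ app gε vs¹ , [] ⟩↓ z) ∈ prev →
            ArgOK prev ρ t eps →
            ArgsOK prev ρ ts vs →
            Rule prev (⟨ app (recF gε g₀ g₁) (t ∷ ts) , ρ ⟩↓ z)
  r-recs  : ∀ {n ρ z t b v₀ v₀¹ v₀² w w¹} {gε : FSym n} {g₀ g₁ : FSym (2 + n)}
              {ts vs vs¹ vs² : Vec Term n} →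
            v₀ ⪯ v₀¹ → v₀ ⪯ v₀² → w ⪯ w¹ → vs ⪯ᵛ vs¹ → vs ⪯ᵛ vs² →
            (⟨ app (select b g₀ g₁) (v₀¹ ∷ w¹ ∷ vs¹) , [] ⟩↓ z) ∈ prev →
            ArgOK prev ρ t (s b v₀) →
            (⟨ app (recF gε g₀ g₁) (v₀² ∷ vs²) , [] ⟩↓ w) ∈ prev →
            ArgsOK prev ρ ts vs →
            Rule prev (⟨ app (recF gε g₀ g₁) (t ∷ ts) , ρ ⟩↓ z)

data Computation : List Stmt → Set where
  []   : Computation []
  _▷_  : ∀ {σ t ρ v} → Computation σ →
         IsDev ρ × GNum v × Rule σ (⟨ t , ρ ⟩↓ v) →
         Computation (σ ∷ʳ (⟨ t , ρ ⟩↓ v))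

{-# OPTIONS --safe #-}
module Submission where

open import Defs
open import Data.List using (List)
open import Data.List.Membership.Propositional using (_∈_)
open import Data.List.Membership.Propositional.Properties using (∈-++⁻)
open import Data.List.Relation.Unary.Any using (here)
open import Data.Fin using (zero)
open import Data.Product using (_,_)
open import Data.Sum using (inj₁; inj₂)
open import Relation.Binary.PropositionalEquality using (refl)

-- A rule whose subject is a g-numeral
-- returns the subject itself, or *, except (s_i), where the earlier entry
-- ⟨t,ρ⟩↓v gives t ⪯ v by induction and hence s_i t ⪯ s_i v ⪯ s_i v*.
-- All other rules have a variable or a PV function application as subject.

⪯-trans : ∀ {a b c} → a ⪯ b → b ⪯ c → a ⪯ c
⪯-trans p         ⪯*          = ⪯*
⪯-trans p         ⪯refl       = p
⪯-trans ⪯refl     (⪯app f q)  = ⪯app f q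
⪯-trans (⪯app f p) (⪯app .f q) = ⪯app f (λ i → ⪯-trans (p i) (q i))

s-mono-⪯ : ∀ {b a c} → a ⪯ c → s b a ⪯ s b c
s-mono-⪯ {b} a⪯c = ⪯app (succF b) λ { zero → a⪯c }

Computation-ind :
  (P : Stmt → Set) →
  (∀ {σ t ρ v} → Computation σ → (∀ {S} → S ∈ σ → P S) →
     IsDev ρ → GNum v → Rule σ (⟨ t , ρ ⟩↓ v) → P (⟨ t , ρ ⟩↓ v)) →
  ∀ {σ} → Computation σ → ∀ {S} → S ∈ σ → P S
Computation-ind P step []                           ()
Computation-ind P step (_▷_ {σ} c (dev , gv , rule)) S∈ with ∈-++⁻ σ S∈
... | inj₁ S∈σ        = Computation-ind P step c S∈σ
... | inj₂ (here refl) = step c (Computation-ind P step c) dev gv rule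

Computation-val-GNum : ∀ {σ} → Computation σ → ∀ {S} → S ∈ σ → GNum (Stmt.val S)
Computation-val-GNum = Computation-ind (λ S → GNum (Stmt.val S)) (λ _ _ _ gv _ → gv)

NumeralBelowValue : Stmt → Set
NumeralBelowValue (⟨ t , _ ⟩↓ v) = GNum t → GNum v → t ⪯ v

Rule-preserves-NumeralBelowValue :
  ∀ {σ t ρ v} → Computation σ → (∀ {S} → S ∈ σ → NumeralBelowValue S) →
  Rule σ (⟨ t , ρ ⟩↓ v) → NumeralBelowValue (⟨ t , ρ ⟩↓ v)
Rule-preserves-NumeralBelowValue c ih r-star           _        _ = ⪯*
Rule-preserves-NumeralBelowValue c ih r-εn             _        _ = ⪯refl
Rule-preserves-NumeralBelowValue c ih (r-ε _ _)        _        _ = ⪯refl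
Rule-preserves-NumeralBelowValue c ih (r-s0 _)         _        _ = ⪯refl
Rule-preserves-NumeralBelowValue c ih (r-sn _ _)       _        _ = ⪯refl
Rule-preserves-NumeralBelowValue c ih (r-s t↓v v⪯v* _) (gs gt)  _ =
  s-mono-⪯ (⪯-trans (ih t↓v gt (Computation-val-GNum c t↓v)) v⪯v*)
Rule-preserves-NumeralBelowValue c ih (r-subst _ _)           () _
Rule-preserves-NumeralBelowValue c ih (r-εm _ _)              () _
Rule-preserves-NumeralBelowValue c ih (r-proj _ _ _)          () _
Rule-preserves-NumeralBelowValue c ih (r-comp _ _ _ _ _ _)    () _
Rule-preserves-NumeralBelowValue c ih (r-recε _ _ _ _)        () _
Rule-preserves-NumeralBelowValue c ih (r-recs _ _ _ _ _ _ _ _ _) () _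

lemma2 : (σ : List Stmt) → Computation σ →
         ∀ {v ρ w} → (⟨ v , ρ ⟩↓ w) ∈ σ → GNum v → GNum w → v ⪯ w
lemma2 σ c = Computation-ind NumeralBelowValue
  (λ c ih _ _ rule → Rule-preserves-NumeralBelowValue c ih rule) c
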